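{- Let $n\ge1$ and $\vec v,\vec w\in\widehat{\mathbb{N}}^n$. Then $\vec v<\vec w$ if and only if $\vec w^\dagger<\vec v^\dagger$. Consequently $\mu(\vec v,\vec w)=\mu(\vec w^\dagger,\vec v^\dagger)$ for all $\vec v,\vec w\in\widehat{\mathbb{N}}^n$, where $\mu$ is the Möbius function of the poset $(\widehat{\mathbb{N}}^n,\le)$.
   Context: $Y_n$ is the set of planar rooted binary trees with $n$ internal vertices, identified with complete parenthesizations of $x_1\cdots x_{n+1}$ (each product of two factors $A,B$ written $(AB)$). The name of $\tau\in Y_n$ is $\mathrm{name}(\tau)=(v_1,\ldots,v_n)$: $v_i=i$ if $x_i$ is immediately preceded by a left parenthesis; otherwise $x_i$ is immediately followed by a nonempty block of right parentheses and $v_i=j$ where $x_j$ is the first variable after the left parenthesis matched with the last right parenthesis of that block. $\widehat{\mathbb{N}}^n$ is the set of names of trees in $Y_n$, ordered componentwise ($\vec a\le\vec b$ iff $a_i\le b_i$ for all $i$; $<$ means $\le$ and $\ne$). The involution $\dagger$ on trees is the mirror image, defined recursively by: the one-leaf tree is fixed, and $(\tau_1\vee\tau_2)^\dagger:=\tau_2^\dagger\vee\tau_1^\dagger$, where $\tau_1\vee\tau_2$ is the tree obtained by identifying the root of $\tau_1$ with the left leaf and the root of $\tau_2$ with the right leaf of the one-vertex tree. On names, $\mathrm{name}(\tau)^\dagger:=\mathrm{name}(\tau^\dagger)$. -}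

module Defs where

open import Data.Nat using (ℕ; zero; suc; _+_; _≟_)
import Data.Nat as ℕ
open import Data.List using (List; []; _∷_; _++_; [_]; map; filter; deduplicate; length; upTo; foldr; concatMap)
open import Data.List.Properties using (≡-dec)
open import Data.List.Relation.Binary.Pointwise using (Pointwise)
import Data.List.Relation.Binary.Pointwise.Properties as PWP
open import Data.Integer using (ℤ; -_) renaming (_+_ to _+ℤ_; 0ℤ to 0ℤ; 1ℤ to 1ℤ)
open import Data.Product using (_×_)
open import Relation.Binary.PropositionalEquality using (_≡_)
open import Relation.Nullary using (¬_; yes; no; Dec; _×-dec_; ¬?)

data Tree : Set where
  leaf : Tree
  node : Tree → Tree → Tree   -- node a b = a ∨ b

size : Tree → ℕ
size leaf = zero
size (node a b) = suc (size a + size b)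

leaves : Tree → ℕ
leaves leaf = 1
leaves (node a b) = leaves a + leaves b

mirror : Tree → Tree
mirror leaf = leaf
mirror (node a b) = node (mirror b) (mirror a)

-- Complete parenthesization of x_1 ... x_{n+1} as a token string

data Tok : Set where
  L : Tok
  R : Tok
  V : ℕ → Tok

-- tokens of a tree whose leaves are numbered starting at offset+1
toks : ℕ → Tree → List Tok
toks k leaf = [ V (suc k) ]
toks k (node a b) = L ∷ (toks k a ++ (toks (k + leaves a) b ++ [ R ]))

countR : List Tok → ℕ
countR (R ∷ ts) = suc (countR ts)
countR _ = zero

-- Scan the reversed prefix before x_i, looking for the left parenthesis
-- matched with the last right parenthesis of the block (d = number of
-- still unmatched right parentheses); v = most recently seen variable,
-- i.e. the first variable after the current position in forward order.
scan : ℕ → ℕ → List Tok → ℕ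
scan d v [] = zero
scan d v (V j ∷ ps) = scan d j ps
scan d v (R ∷ ps) = scan (suc d) v ps
scan zero v (L ∷ ps) = zero
scan (suc zero) v (L ∷ ps) = v
scan (suc (suc d)) v (L ∷ ps) = scan (suc d) v ps

-- i = variable index, pre = reversed prefix before x_i, rest = tokens after x_i
decideAt : ℕ → List Tok → List Tok → ℕ
decideAt i (L ∷ _) rest = i
decideAt i pre rest = scan (countR rest) i pre

findVar : ℕ → List Tok → List Tok → ℕ
findVar i pre [] = zero
findVar i pre (V j ∷ rest) with j ≟ i
... | yes _ = decideAt i pre rest
... | no _ = findVar i (V j ∷ pre) rest
findVar i pre (t ∷ rest) = findVar i (t ∷ pre) rest

name : Tree → List ℕ
name t = map (λ i → findVar (suc i) [] (toks zero t)) (upTo (size t))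

_≤ᶜ_ : List ℕ → List ℕ → Set
v ≤ᶜ w = Pointwise ℕ._≤_ v w

_<ᶜ_ : List ℕ → List ℕ → Set
v <ᶜ w = (v ≤ᶜ w) × ¬ (v ≡ w)

_≤ᶜ?_ : (v w : List ℕ) → Dec (v ≤ᶜ w)
v ≤ᶜ? w = PWP.decidable ℕ._≤?_ v w

_≟ᴸ_ : (v w : List ℕ) → Dec (v ≡ w)
_≟ᴸ_ = ≡-dec _≟_

-- all trees of height ≤ k (each exactly once)
treesUpTo : ℕ → List Tree
treesUpTo zero = [ leaf ]
treesUpTo (suc k) = leaf ∷ concatMap (λ a → map (node a) (treesUpTo k)) (treesUpTo k)

Y : ℕ → List Tree
Y n = filter (λ t → size t ≟ n) (treesUpTo n)

-- \hat{N}^n as a (duplicate-free) list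
Names : ℕ → List (List ℕ)
Names n = deduplicate _≟ᴸ_ (map name (Y n))

sumℤ : List ℤ → ℤ
sumℤ = foldr _+ℤ_ 0ℤ

-- Möbius function of a finite poset P (given as a list of its elements),
-- by the standard recursion μ(x,x)=1, μ(x,y) = - Σ_{x ≤ z < y} μ(x,z)
-- for x < y, μ(x,y) = 0 otherwise; the first argument is recursion fuel.
mobiusFuel : ℕ → List (List ℕ) → List ℕ → List ℕ → ℤ
mobiusFuel zero P x y = 0ℤ
mobiusFuel (suc f) P x y with x ≟ᴸ y
... | yes _ = 1ℤ
... | no _ with x ≤ᶜ? y
...   | no _ = 0ℤ
...   | yes _ = - sumℤ (map (mobiusFuel f P x)
                         (filter (λ z → (x ≤ᶜ? z) ×-dec ((z ≤ᶜ? y) ×-dec ¬? (z ≟ᴸ y))) P))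

-- Möbius function of (\hat{N}^n, ≤); fuel = |P| exceeds every chain length
μ : ℕ → List ℕ → List ℕ → ℤ
μ n = mobiusFuel (length (Names n)) (Names n)

module Submission where

-- Number the internal vertices of a tree 1, …, n in in-order.  The subtree rooted at
-- vertex i then occupies an interval [spanStart i, spanEnd i] of vertices, and the name
-- of a tree is exactly its vector of spanStart values.  Mirroring reverses the in-order,
-- so vertex i of τ becomes vertex n + 1 − i of τ† and its interval is reflected:
-- spanStart of τ† at n + 1 − i is n + 1 − spanEnd of τ at i.  The spanEnd vector is
-- monotone in the name: if spanEnd σ i < spanEnd τ i, the vertex j = spanEnd σ i + 1 lies
-- in the τ-subtree of i, so spanStart τ j > i, but not in the σ-subtree of i, so
-- spanStart σ j ≤ i.  Hence v ≤ w implies w† ≤ v†, so † is an order-reversing involution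
-- of the poset of names.  Writing μ(x, y) as the alternating number of chains from x to y
-- (Philip Hall), reversing every chain gives μ(x, y) = μ(y†, x†).

open import Defs

open import Data.Bool using (Bool; true; false; if_then_else_; _∧_)
open import Data.Empty using (⊥-elim)
open import Data.Integer using (ℤ; -_; 0ℤ; 1ℤ) renaming (_+_ to _+ℤ_)
import Data.Integer.Properties as ℤ
open import Data.List using (List; []; _∷_; _++_; [_]; _ʳ++_; map; filter; length; applyUpTo; upTo)
open import Data.List.Membership.Propositional using (_∈_; lose)
open import Data.List.Membership.Propositional.Properties
  using (∈-upTo⁻; ∈-map⁺; ∈-map⁻; ∈-concatMap⁺; ∈-filter⁺; ∈-filter⁻; ∈-deduplicate⁺; ∈-deduplicate⁻)
open import Data.List.Properties
  using (++-assoc; ++-ʳ++; ++-identityʳ; map-cong-local; map-upTo; map-applyUpTo; length-map; length-upTo)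
open import Data.List.Relation.Binary.Pointwise as Pointwise using (Pointwise; []; _∷_)
import Data.List.Relation.Unary.All as All
open import Data.List.Relation.Unary.Any using (here; there)
open import Data.List.Relation.Unary.Unique.Propositional using (Unique; _∷_)
open import Data.List.Relation.Unary.Unique.DecPropositional.Properties _≟ᴸ_ using (deduplicate-!)
open import Data.Nat using (ℕ; zero; suc; pred; _+_; _≤_; _<_; z≤n; s≤s; z<s; _≟_; _≤?_)
open import Data.Nat.Properties
open import Algebra.Properties.CommutativeSemigroup +-commutativeSemigroup using (x∙yz≈y∙xz)
open import Algebra.Properties.CommutativeSemigroup ℤ.+-commutativeSemigroup using (interchange)
open import Data.Product using (_×_; _,_; proj₂; ∃-syntax)
open import Data.Sum using (inj₁; inj₂)
open import Function using (_∘_)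
open import Function.Bundles using (_⇔_; mk⇔)
open import Relation.Binary.Definitions using (DecidableEquality)
open import Relation.Binary.PropositionalEquality hiding ([_])
open import Relation.Nullary using (Dec; does; yes; no; ¬_; _×-dec_; ¬?)
open import Relation.Nullary.Decidable using (dec-true; dec-false; does-⇔)

private
  variable
    A B : Set

_when_ : ℤ → Bool → ℤ
v when b = if b then v else 0ℤ

∑ : List A → (A → ℤ) → ℤ
∑ xs f = sumℤ (map f xs)

∑-cong : ∀ xs {f g : A → ℤ} → (∀ {x} → x ∈ xs → f x ≡ g x) → ∑ xs f ≡ ∑ xs g
∑-cong []       f≡g = refl
∑-cong (x ∷ xs) f≡g = cong₂ _+ℤ_ (f≡g (here refl)) (∑-cong xs (f≡g ∘ there))

∑-zero : ∀ xs {f : A → ℤ} → (∀ {x} → x ∈ xs → f x ≡ 0ℤ) → ∑ xs f ≡ 0ℤ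
∑-zero xs f≡0 = trans (∑-cong xs f≡0) (∑-0 xs)
  where
  ∑-0 : ∀ xs → ∑ xs (λ _ → 0ℤ) ≡ 0ℤ
  ∑-0 []       = refl
  ∑-0 (_ ∷ xs) = trans (ℤ.+-identityˡ _) (∑-0 xs)

∑-+ : ∀ xs (f g : A → ℤ) → ∑ xs (λ x → f x +ℤ g x) ≡ ∑ xs f +ℤ ∑ xs g
∑-+ []       f g = refl
∑-+ (x ∷ xs) f g =
  trans (cong (f x +ℤ g x +ℤ_) (∑-+ xs f g)) (interchange (f x) (g x) _ _)

∑-neg : ∀ xs (f : A → ℤ) → ∑ xs (λ x → - f x) ≡ - ∑ xs f
∑-neg []       f = refl
∑-neg (x ∷ xs) f = trans (cong (- f x +ℤ_) (∑-neg xs f)) (sym (ℤ.neg-distrib-+ (f x) _))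

∑-swap : ∀ xs ys (h : A → B → ℤ) → ∑ xs (λ x → ∑ ys (h x)) ≡ ∑ ys (λ y → ∑ xs (λ x → h x y))
∑-swap []       ys h = sym (∑-zero ys (λ _ → refl))
∑-swap (x ∷ xs) ys h = trans (cong (∑ ys (h x) +ℤ_) (∑-swap xs ys h)) (sym (∑-+ ys (h x) _))

∑-upTo-suc : ∀ n (h : ℕ → ℤ) → ∑ (upTo (suc n)) h ≡ h 0 +ℤ ∑ (upTo n) (h ∘ suc)
∑-upTo-suc n h = cong (λ hs → h 0 +ℤ sumℤ hs) (trans (map-applyUpTo suc h n) (sym (map-upTo (h ∘ suc) n)))

∑-filter : ∀ {P : A → Set} (P? : ∀ x → Dec (P x)) (f : A → ℤ) xs →
           sumℤ (map f (filter P? xs)) ≡ ∑ xs (λ x → f x when does (P? x))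
∑-filter P? f []       = refl
∑-filter P? f (x ∷ xs) with does (P? x)
... | true  = cong (f x +ℤ_) (∑-filter P? f xs)
... | false = trans (∑-filter P? f xs) (sym (ℤ.+-identityˡ _))

∑-δ : (_≟_ : DecidableEquality A) {a : A} (f : A → ℤ) {xs : List A} →
      Unique xs → a ∈ xs → ∑ xs (λ x → f x when does (x ≟ a)) ≡ f a
∑-δ _≟_ {a} f (a∉xs ∷ _) (here refl) =
  trans (cong₂ _+ℤ_ (cong (f a when_) (dec-true (a ≟ a) refl)) (∑-zero _ λ {x} x∈xs →
           cong (f x when_) (dec-false (x ≟ a) λ x≡a → All.lookup a∉xs x∈xs (sym x≡a))))
        (ℤ.+-identityʳ (f a))
∑-δ _≟_ {a} f {x ∷ xs} (x∉xs ∷ xs-unique) (there a∈xs) =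
  trans (cong (_+ℤ ∑ xs (λ y → f y when does (y ≟ a)))
              (cong (f x when_) (dec-false (x ≟ a) (All.lookup x∉xs a∈xs))))
        (trans (ℤ.+-identityˡ _) (∑-δ _≟_ f xs-unique a∈xs))

when-∑ : ∀ b xs (f : A → ℤ) → ∑ xs f when b ≡ ∑ xs (λ x → f x when b)
when-∑ true  xs f = refl
when-∑ false xs f = sym (∑-zero xs (λ _ → refl))

neg-when : ∀ v b → (- v) when b ≡ - (v when b)
neg-when v true  = refl
neg-when v false = refl

when-when : ∀ v b c → (v when b) when c ≡ v when (c ∧ b)
when-when v b true  = refl
when-when v b false = refl

when²-⇔ : ∀ {P Q R S : Set} v (P? : Dec P) (Q? : Dec Q) (R? : Dec R) (S? : Dec S) → (P × Q) ⇔ (R × S) →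
          (v when does Q?) when does P? ≡ (v when does S?) when does R?
when²-⇔ v P? Q? R? S? PQ⇔RS = begin
  (v when does Q?) when does P?  ≡⟨ when-when v (does Q?) (does P?) ⟩
  v when does (P? ×-dec Q?)      ≡⟨ cong (v when_) (does-⇔ PQ⇔RS (P? ×-dec Q?) (R? ×-dec S?)) ⟩
  v when does (R? ×-dec S?)      ≡⟨ when-when v (does S?) (does R?) ⟨
  (v when does S?) when does R?  ∎
  where open ≡-Reasoning

neg-∑-when-neg : ∀ xs ys (b : A → Bool) (f : A → B → ℤ) →
                 - ∑ xs (λ x → (- ∑ ys (f x)) when b x) ≡ ∑ xs (λ x → ∑ ys (λ y → f x y when b x))
neg-∑-when-neg xs ys b f = begin
  - ∑ xs (λ x → (- ∑ ys (f x)) when b x)    ≡⟨ cong -_ (∑-cong xs λ {x} _ → neg-when (∑ ys (f x)) (b x)) ⟩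
  - ∑ xs (λ x → - (∑ ys (f x) when b x))    ≡⟨ cong -_ (∑-neg xs _) ⟩
  - - ∑ xs (λ x → ∑ ys (f x) when b x)      ≡⟨ ℤ.neg-involutive _ ⟩
  ∑ xs (λ x → ∑ ys (f x) when b x)          ≡⟨ ∑-cong xs (λ {x} _ → when-∑ (b x) ys (f x)) ⟩
  ∑ xs (λ x → ∑ ys (λ y → f x y when b x))  ∎
  where open ≡-Reasoning

≤ᶜ-refl : ∀ {x} → x ≤ᶜ x
≤ᶜ-refl = Pointwise.refl ≤-refl

≤ᶜ-trans : ∀ {x y z} → x ≤ᶜ y → y ≤ᶜ z → x ≤ᶜ z
≤ᶜ-trans = Pointwise.transitive ≤-trans

≤ᶜ-antisym : ∀ {x y} → x ≤ᶜ y → y ≤ᶜ x → x ≡ y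
≤ᶜ-antisym x≤y y≤x = Pointwise.Pointwise-≡⇒≡ (Pointwise.antisymmetric ≤-antisym x≤y y≤x)

Ico : List ℕ → List ℕ → List ℕ → Set
Ico x y z = x ≤ᶜ z × z ≤ᶜ y × ¬ z ≡ y

Ioc : List ℕ → List ℕ → List ℕ → Set
Ioc x y w = x ≤ᶜ w × w ≤ᶜ y × ¬ x ≡ w

Ico? : ∀ x y z → Dec (Ico x y z)
Ico? x y z = (x ≤ᶜ? z) ×-dec ((z ≤ᶜ? y) ×-dec ¬? (z ≟ᴸ y))

Ioc? : ∀ x y w → Dec (Ioc x y w)
Ioc? x y w = (x ≤ᶜ? w) ×-dec ((w ≤ᶜ? y) ×-dec ¬? (x ≟ᴸ w))

module Chains (P : List (List ℕ)) where

  -- chains k x y = (-1)^k · #{x = z₀ < z₁ < ⋯ < z_k = y in P}, counted by removing the top element.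
  chains : ℕ → List ℕ → List ℕ → ℤ
  chains zero    x y = 1ℤ when does (x ≟ᴸ y)
  chains (suc k) x y = - ∑ P (λ z → chains k x z when does (Ico? x y z))

  chains-diag : ∀ k x → chains (suc k) x x ≡ 0ℤ
  chains-diag k x = cong -_ (∑-zero P λ {z} _ →
    cong (chains k x z when_) (dec-false (Ico? x x z) λ (x≤z , z≤x , z≢x) → z≢x (≤ᶜ-antisym z≤x x≤z)))

  chains-≰ : ∀ k {x y} → ¬ x ≤ᶜ y → chains k x y ≡ 0ℤ
  chains-≰ zero    {x} {y} x≰y = cong (1ℤ when_) (dec-false (x ≟ᴸ y) λ { refl → x≰y ≤ᶜ-refl })
  chains-≰ (suc k) {x} {y} x≰y = cong -_ (∑-zero P λ {z} _ →
    cong (chains k x z when_) (dec-false (Ico? x y z) λ (x≤z , z≤y , _) → x≰y (≤ᶜ-trans x≤z z≤y)))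

  -- Holds for every fuel f, so the fuel in μ never has to be shown to suffice.
  mobiusFuel-chains : ∀ f x y → mobiusFuel f P x y ≡ ∑ (upTo f) (λ k → chains k x y)
  mobiusFuel-chains zero    x y = refl
  mobiusFuel-chains (suc f) x y = trans mobiusFuel-suc (sym (∑-upTo-suc f (λ k → chains k x y)))
    where
    mobiusFuel-suc : mobiusFuel (suc f) P x y ≡ chains 0 x y +ℤ ∑ (upTo f) (λ k → chains (suc k) x y)
    mobiusFuel-suc with x ≟ᴸ y
    ... | yes refl = sym (cong (1ℤ +ℤ_) (∑-zero (upTo f) λ {k} _ → chains-diag k x))
    ... | no x≢y with x ≤ᶜ? y
    ...   | no x≰y = sym (cong (0ℤ +ℤ_) (∑-zero (upTo f) λ {k} _ → chains-≰ (suc k) x≰y))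
    ...   | yes _  = begin
      - sumℤ (map (mobiusFuel f P x) (filter (Ico? x y) P))
        ≡⟨ cong -_ (∑-filter (Ico? x y) (mobiusFuel f P x) P) ⟩
      - ∑ P (λ z → mobiusFuel f P x z when does (Ico? x y z))
        ≡⟨ cong -_ (∑-cong P λ {z} _ → trans (cong (_when does (Ico? x y z)) (mobiusFuel-chains f x z))
                                              (when-∑ (does (Ico? x y z)) (upTo f) _)) ⟩
      - ∑ P (λ z → ∑ (upTo f) (λ k → chains k x z when does (Ico? x y z)))
        ≡⟨ cong -_ (∑-swap P (upTo f) _) ⟩
      - ∑ (upTo f) (λ k → ∑ P (λ z → chains k x z when does (Ico? x y z)))
        ≡⟨ ∑-neg (upTo f) _ ⟨
      ∑ (upTo f) (λ k → chains (suc k) x y)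
        ≡⟨ ℤ.+-identityˡ _ ⟨
      0ℤ +ℤ ∑ (upTo f) (λ k → chains (suc k) x y)  ∎
      where open ≡-Reasoning

  module _ (unique : Unique P) where

    chains-right : ∀ k {x y} → x ∈ P → y ∈ P →
                   chains (suc k) x y ≡ - ∑ P (λ w → chains k w y when does (Ioc? x y w))
    chains-right zero {x} {y} x∈P y∈P = cong -_ (begin
      ∑ P (λ z → (1ℤ when does (x ≟ᴸ z)) when does (Ico? x y z))
        ≡⟨ ∑-cong P (λ {z} _ → when²-⇔ 1ℤ (Ico? x y z) (x ≟ᴸ z) (z ≟ᴸ x) (Ico? x y z)
                                  (mk⇔ (λ (c , e) → sym e , c) (λ (e , c) → c , sym e))) ⟩
      ∑ P (λ z → (1ℤ when does (Ico? x y z)) when does (z ≟ᴸ x))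
        ≡⟨ ∑-δ _≟ᴸ_ (λ z → 1ℤ when does (Ico? x y z)) unique x∈P ⟩
      1ℤ when does (Ico? x y x)
        ≡⟨ cong (1ℤ when_) (does-⇔ Ico-x⇔Ioc-y (Ico? x y x) (Ioc? x y y)) ⟩
      1ℤ when does (Ioc? x y y)
        ≡⟨ ∑-δ _≟ᴸ_ (λ w → 1ℤ when does (Ioc? x y w)) unique y∈P ⟨
      ∑ P (λ w → (1ℤ when does (Ioc? x y w)) when does (w ≟ᴸ y))
        ≡⟨ ∑-cong P (λ {w} _ → when²-⇔ 1ℤ (w ≟ᴸ y) (Ioc? x y w) (Ioc? x y w) (w ≟ᴸ y)
                                  (mk⇔ (λ (e , c) → c , e) (λ (c , e) → e , c))) ⟩
      ∑ P (λ w → (1ℤ when does (w ≟ᴸ y)) when does (Ioc? x y w))  ∎)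
      where
      open ≡-Reasoning
      Ico-x⇔Ioc-y : Ico x y x ⇔ Ioc x y y
      Ico-x⇔Ioc-y = mk⇔ (λ (_ , x≤y , x≢y) → x≤y , ≤ᶜ-refl , x≢y)
                        (λ (x≤y , _ , x≢y) → ≤ᶜ-refl , x≤y , x≢y)
    chains-right (suc k) {x} {y} x∈P y∈P = begin
      - ∑ P (λ z → chains (suc k) x z when does (Ico? x y z))
        ≡⟨ cong -_ (∑-cong P λ {z} z∈P → cong (_when does (Ico? x y z)) (chains-right k x∈P z∈P)) ⟩
      - ∑ P (λ z → (- ∑ P (λ w → chains k w z when does (Ioc? x z w))) when does (Ico? x y z))
        ≡⟨ neg-∑-when-neg P P (λ z → does (Ico? x y z)) _ ⟩
      ∑ P (λ z → ∑ P (λ w → (chains k w z when does (Ioc? x z w)) when does (Ico? x y z)))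
        ≡⟨ ∑-swap P P _ ⟩
      ∑ P (λ w → ∑ P (λ z → (chains k w z when does (Ioc? x z w)) when does (Ico? x y z)))
        ≡⟨ ∑-cong P (λ {w} _ → ∑-cong P λ {z} _ →
             when²-⇔ _ (Ico? x y z) (Ioc? x z w) (Ioc? x y w) (Ico? w y z) (mk⇔ to from)) ⟩
      ∑ P (λ w → ∑ P (λ z → (chains k w z when does (Ico? w y z)) when does (Ioc? x y w)))
        ≡⟨ neg-∑-when-neg P P (λ w → does (Ioc? x y w)) _ ⟨
      - ∑ P (λ w → chains (suc k) w y when does (Ioc? x y w))  ∎
      where
      open ≡-Reasoning
      to : ∀ {z w} → Ico x y z × Ioc x z w → Ioc x y w × Ico w y z
      to ((_ , z≤y , z≢y) , (x≤w , w≤z , x≢w)) = (x≤w , ≤ᶜ-trans w≤z z≤y , x≢w) , (w≤z , z≤y , z≢y)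
      from : ∀ {z w} → Ioc x y w × Ico w y z → Ico x y z × Ioc x z w
      from ((x≤w , _ , x≢w) , (w≤z , z≤y , z≢y)) = (≤ᶜ-trans x≤w w≤z , z≤y , z≢y) , (x≤w , w≤z , x≢w)

    module _ (D : List ℕ → List ℕ) (D-∈ : ∀ {x} → x ∈ P → D x ∈ P)
             (D-involutive : ∀ {x} → x ∈ P → D (D x) ≡ x)
             (D-antitone : ∀ {x y} → x ∈ P → y ∈ P → x ≤ᶜ y → D y ≤ᶜ D x) where

      D-swap : ∀ {x y} → x ∈ P → y ≡ D x → x ≡ D y
      D-swap x∈P y≡Dx = trans (sym (D-involutive x∈P)) (cong D (sym y≡Dx))

      D-injective : ∀ {x y} → x ∈ P → y ∈ P → D x ≡ D y → x ≡ y
      D-injective x∈P y∈P Dx≡Dy = trans (D-swap x∈P (sym Dx≡Dy)) (D-involutive y∈P)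

      D-reflects : ∀ {x y} → x ∈ P → y ∈ P → D y ≤ᶜ D x → x ≤ᶜ y
      D-reflects x∈P y∈P Dy≤Dx =
        subst₂ _≤ᶜ_ (D-involutive x∈P) (D-involutive y∈P) (D-antitone (D-∈ y∈P) (D-∈ x∈P) Dy≤Dx)

      ∑-reindex : ∀ g → ∑ P g ≡ ∑ P (g ∘ D)
      ∑-reindex g = begin
        ∑ P g
          ≡⟨ ∑-cong P (λ {z} z∈P → ∑-δ _≟ᴸ_ (λ _ → g z) unique (D-∈ z∈P)) ⟨
        ∑ P (λ z → ∑ P (λ w → g z when does (w ≟ᴸ D z)))
          ≡⟨ ∑-cong P (λ {z} z∈P → ∑-cong P λ {w} w∈P →
               cong (g z when_) (does-⇔ (mk⇔ (D-swap z∈P) (D-swap w∈P)) (w ≟ᴸ D z) (z ≟ᴸ D w))) ⟩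
        ∑ P (λ z → ∑ P (λ w → g z when does (z ≟ᴸ D w)))
          ≡⟨ ∑-swap P P _ ⟩
        ∑ P (λ w → ∑ P (λ z → g z when does (z ≟ᴸ D w)))
          ≡⟨ ∑-cong P (λ w∈P → ∑-δ _≟ᴸ_ g unique (D-∈ w∈P)) ⟩
        ∑ P (g ∘ D)  ∎
        where open ≡-Reasoning

      chains-dual : ∀ k {x y} → x ∈ P → y ∈ P → chains k (D y) (D x) ≡ chains k x y
      chains-dual zero {x} {y} x∈P y∈P = cong (1ℤ when_) (does-⇔ Dy≡Dx⇔x≡y (D y ≟ᴸ D x) (x ≟ᴸ y))
        where
        Dy≡Dx⇔x≡y : D y ≡ D x ⇔ x ≡ y
        Dy≡Dx⇔x≡y = mk⇔ (λ Dy≡Dx → sym (D-injective y∈P x∈P Dy≡Dx)) (λ x≡y → cong D (sym x≡y))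
      chains-dual (suc k) {x} {y} x∈P y∈P = begin
        - ∑ P (λ z → chains k (D y) z when does (Ico? (D y) (D x) z))
          ≡⟨ cong -_ (∑-reindex _) ⟩
        - ∑ P (λ w → chains k (D y) (D w) when does (Ico? (D y) (D x) (D w)))
          ≡⟨ cong -_ (∑-cong P λ {w} w∈P →
             cong₂ _when_ (chains-dual k w∈P y∈P) (does-⇔ (Ico-D⇔Ioc w∈P) (Ico? (D y) (D x) (D w)) (Ioc? x y w))) ⟩
        - ∑ P (λ w → chains k w y when does (Ioc? x y w))
          ≡⟨ chains-right k x∈P y∈P ⟨
        chains (suc k) x y  ∎
        where
        open ≡-Reasoning
        Ico-D⇔Ioc : ∀ {w} → w ∈ P → Ico (D y) (D x) (D w) ⇔ Ioc x y w
        Ico-D⇔Ioc w∈P = mk⇔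
          (λ (Dy≤Dw , Dw≤Dx , Dw≢Dx) →
             D-reflects x∈P w∈P Dw≤Dx , D-reflects w∈P y∈P Dy≤Dw , λ x≡w → Dw≢Dx (cong D (sym x≡w)))
          (λ (x≤w , w≤y , x≢w) →
             D-antitone w∈P y∈P w≤y , D-antitone x∈P w∈P x≤w ,
             λ Dw≡Dx → x≢w (sym (D-injective w∈P x∈P Dw≡Dx)))

      mobiusFuel-dual : ∀ f {x y} → x ∈ P → y ∈ P → mobiusFuel f P x y ≡ mobiusFuel f P (D y) (D x)
      mobiusFuel-dual f {x} {y} x∈P y∈P = begin
        mobiusFuel f P x y                       ≡⟨ mobiusFuel-chains f x y ⟩
        ∑ (upTo f) (λ k → chains k x y)          ≡⟨ ∑-cong (upTo f) (λ {k} _ → chains-dual k x∈P y∈P) ⟨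
        ∑ (upTo f) (λ k → chains k (D y) (D x))  ≡⟨ mobiusFuel-chains f (D y) (D x) ⟨
        mobiusFuel f P (D y) (D x)               ∎
        where open ≡-Reasoning

-- Subtree spans

-- `after d` exposes j − s as suc d, so no truncated subtraction is needed.
data Split (s : ℕ) : ℕ → Set where
  before : ∀ {j} → j < s → Split s j
  at     : Split s s
  after  : ∀ d → Split s (s + suc d)

Split-suc : ∀ {s j} → Split s j → Split (suc s) (suc j)
Split-suc (before j<s) = before (s≤s j<s)
Split-suc at           = at
Split-suc (after d)    = after d

split : ∀ s j → Split s j
split zero    zero    = at
split zero    (suc d) = after d
split (suc s) zero    = before z<s
split (suc s) (suc j) = Split-suc (split s j)

split-before : ∀ {s j} (j<s : j < s) → split s j ≡ before j<s
split-before {suc s} {zero}  (s≤s z≤n) = refl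
split-before {suc s} {suc j} (s≤s j<s) = cong Split-suc (split-before j<s)

split-at : ∀ s → split s s ≡ at
split-at zero    = refl
split-at (suc s) = cong Split-suc (split-at s)

split-after : ∀ s d → split s (s + suc d) ≡ after d
split-after zero    d = refl
split-after (suc s) d = cong Split-suc (split-after s d)

data Above (s : ℕ) : ℕ → Set where
  above : ∀ d → Above s (s + suc d)

split-above : ∀ {s j} → s < j → Above s j
split-above {s} {j} s<j with split s j
... | before j<s = ⊥-elim (<-asym s<j j<s)
... | at         = ⊥-elim (<-irrefl refl s<j)
... | after d    = above d

caseSplit : ∀ {s j} → (ℕ → A) → A → (ℕ → A) → Split s j → A
caseSplit {j = j} f x g (before _) = f j
caseSplit         f x g at         = x
caseSplit         f x g (after d)  = g (suc d)

bySplit : ℕ → (ℕ → A) → A → (ℕ → A) → ℕ → A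
bySplit s f x g j = caseSplit f x g (split s j)

-- In the in-order numbering the root of node a b is vertex suc (size a).  Outside
-- 1 … size t both functions return junk.
spanStart : Tree → ℕ → ℕ
spanStart leaf       _ = 0
spanStart (node a b) = bySplit (suc (size a)) (spanStart a) 1 (λ j → suc (size a) + spanStart b j)

spanEnd : Tree → ℕ → ℕ
spanEnd leaf       _ = 0
spanEnd (node a b) = bySplit (suc (size a)) (spanEnd a) (size (node a b)) (λ i → suc (size a) + spanEnd b i)

module _ (a b : Tree) where

  spanStart-before : ∀ {j} → j < suc (size a) → spanStart (node a b) j ≡ spanStart a j
  spanStart-before j<s = cong (caseSplit (spanStart a) 1 _) (split-before j<s)

  spanStart-root : spanStart (node a b) (suc (size a)) ≡ 1
  spanStart-root = cong (caseSplit (spanStart a) 1 _) (split-at (suc (size a)))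

  spanStart-after : ∀ d → spanStart (node a b) (suc (size a) + suc d) ≡ suc (size a) + spanStart b (suc d)
  spanStart-after d = cong (caseSplit (spanStart a) 1 _) (split-after (suc (size a)) d)

spanStart-positive : ∀ t {j} → 1 ≤ j → j ≤ size t → 1 ≤ spanStart t j
spanStart-positive leaf       () z≤n
spanStart-positive (node a b) {j} 1≤j j≤n with split (suc (size a)) j
... | before j<s = spanStart-positive a 1≤j (≤-pred j<s)
... | at         = ≤-refl
... | after d    = s≤s z≤n

spanEnd≤size : ∀ t i → spanEnd t i ≤ size t
spanEnd≤size leaf       i = z≤n
spanEnd≤size (node a b) i with split (suc (size a)) i
... | before _ = m≤n⇒m≤1+n (≤-trans (spanEnd≤size a i) (m≤m+n (size a) (size b)))
... | at       = ≤-refl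
... | after d  = +-monoʳ-≤ (suc (size a)) (spanEnd≤size b (suc d))

i≤spanEnd : ∀ t {i} → i ≤ size t → i ≤ spanEnd t i
i≤spanEnd leaf       z≤n = z≤n
i≤spanEnd (node a b) {i} i≤n with split (suc (size a)) i
... | before i<s = i≤spanEnd a (≤-pred i<s)
... | at         = i≤n
... | after d    = +-monoʳ-≤ (suc (size a)) (i≤spanEnd b (+-cancelˡ-≤ (suc (size a)) _ _ i≤n))

spanStart-inside : ∀ t {i j} → i < j → j ≤ spanEnd t i → i < spanStart t j
spanStart-inside leaf () z≤n
spanStart-inside (node a b) {i} {j} i<j j≤e with split (suc (size a)) i
... | before i<s = begin-strict
  i                       <⟨ spanStart-inside a i<j j≤e ⟩
  spanStart a j           ≡⟨ spanStart-before a b (s≤s (≤-trans j≤e (spanEnd≤size a i))) ⟨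
  spanStart (node a b) j  ∎
  where open ≤-Reasoning
... | at with split-above i<j
...   | above d = begin-strict
  suc (size a)                        <⟨ m<m+n (suc (size a)) (spanStart-positive b (s≤s z≤n) d<b) ⟩
  suc (size a) + spanStart b (suc d)  ≡⟨ spanStart-after a b d ⟨
  spanStart (node a b) j              ∎
  where
  open ≤-Reasoning
  d<b : suc d ≤ size b
  d<b = +-cancelˡ-≤ (suc (size a)) _ _ j≤e
spanStart-inside (node a b) {i} {j} i<j j≤e | after d with split-above (<-trans (m<m+n (suc (size a)) z<s) i<j)
...   | above e = begin-strict
  s + suc d                <⟨ +-monoʳ-< s (spanStart-inside b (+-cancelˡ-< s _ _ i<j) (+-cancelˡ-≤ s _ _ j≤e)) ⟩
  s + spanStart b (suc e)  ≡⟨ spanStart-after a b e ⟨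
  spanStart (node a b) j   ∎
  where
  open ≤-Reasoning
  s = suc (size a)

spanStart-next : ∀ t {i} → 1 ≤ i → spanEnd t i < size t → spanStart t (suc (spanEnd t i)) ≤ i
spanStart-next leaf       _ ()
spanStart-next (node a b) {i} 1≤i e<n with split (suc (size a)) i
... | before i<s with m≤n⇒m<n∨m≡n (spanEnd≤size a i)
...   | inj₁ e<sa = begin
  spanStart (node a b) (suc (spanEnd a i))  ≡⟨ spanStart-before a b (s≤s e<sa) ⟩
  spanStart a (suc (spanEnd a i))           ≤⟨ spanStart-next a 1≤i e<sa ⟩
  i                                         ∎
  where open ≤-Reasoning
...   | inj₂ e≡sa = begin
  spanStart (node a b) (suc (spanEnd a i))  ≡⟨ cong (spanStart (node a b) ∘ suc) e≡sa ⟩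
  spanStart (node a b) (suc (size a))       ≡⟨ spanStart-root a b ⟩
  1                                         ≤⟨ 1≤i ⟩
  i                                         ∎
  where open ≤-Reasoning
spanStart-next (node a b) 1≤i e<n | at      = ⊥-elim (<-irrefl refl e<n)
spanStart-next (node a b) 1≤i e<n | after d = begin
  spanStart (node a b) (suc (s + e))  ≡⟨ cong (spanStart (node a b)) (sym (+-suc s e)) ⟩
  spanStart (node a b) (s + suc e)    ≡⟨ spanStart-after a b e ⟩
  s + spanStart b (suc e)             ≤⟨ +-monoʳ-≤ s (spanStart-next b (s≤s z≤n) (+-cancelˡ-< s _ _ e<n)) ⟩
  s + suc d                           ∎
  where
  open ≤-Reasoning
  s = suc (size a)
  e = spanEnd b (suc d)

_≤[_]_ : (ℕ → ℕ) → ℕ → (ℕ → ℕ) → Set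
f ≤[ n ] g = ∀ {j} → 1 ≤ j → j ≤ n → f j ≤ g j

spanEnd-mono : ∀ τ σ → size τ ≡ size σ →
               spanStart τ ≤[ size τ ] spanStart σ → spanEnd τ ≤[ size τ ] spanEnd σ
spanEnd-mono τ σ same start≤ {i} 1≤i i≤n with spanEnd τ i ≤? spanEnd σ i
... | yes end≤ = end≤
... | no  end≰ = ⊥-elim (<-irrefl refl (begin-strict
  i              <⟨ spanStart-inside τ i<j j≤endτ ⟩
  spanStart τ j  ≤⟨ start≤ (s≤s z≤n) j≤n ⟩
  spanStart σ j  ≤⟨ spanStart-next σ 1≤i (subst (spanEnd σ i <_) same j≤n) ⟩
  i              ∎))
  where
  open ≤-Reasoning
  j = suc (spanEnd σ i)
  j≤endτ : j ≤ spanEnd τ i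
  j≤endτ = ≰⇒> end≰
  i<j : i < j
  i<j = s≤s (i≤spanEnd σ (subst (i ≤_) same i≤n))
  j≤n : j ≤ size τ
  j≤n = ≤-trans j≤endτ (spanEnd≤size τ i)

size-mirror : ∀ t → size (mirror t) ≡ size t
size-mirror leaf       = refl
size-mirror (node a b) = cong suc (trans (cong₂ _+_ (size-mirror b) (size-mirror a)) (+-comm (size b) (size a)))

mirror-involutive : ∀ t → mirror (mirror t) ≡ t
mirror-involutive leaf       = refl
mirror-involutive (node a b) = cong₂ node (mirror-involutive a) (mirror-involutive b)

MirrorSpans : Tree → Set
MirrorSpans t = ∀ {i k} → 1 ≤ i → 1 ≤ k → i + k ≡ suc (size t) →
                spanStart (mirror t) k + spanEnd t i ≡ suc (size t)

module _ {a b : Tree} (ih-a : MirrorSpans a) (ih-b : MirrorSpans b) where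
  open ≡-Reasoning

  private
    s  = suc (size a)
    s′ = suc (size (mirror b))
    a′ = mirror a
    b′ = mirror b

    size-node : suc (size (node a b)) ≡ s + s′
    size-node = trans (cong suc (sym (+-suc (size a) (size b)))) (cong (λ m → s + suc m) (sym (size-mirror b)))

    spans : ∀ {i k} → 1 ≤ i → 1 ≤ k → i + k ≡ s + s′ →
            spanStart (node b′ a′) k + spanEnd (node a b) i ≡ suc (size (node a b))
    spans {i} {k} 1≤i 1≤k i+k≡ with split s i
    ... | before i<s with split-above (+-cancelˡ-< s s′ k (subst (_< s + k) i+k≡ (+-monoˡ-< k i<s)))
    ...   | above e = begin
      spanStart (node b′ a′) (s′ + suc e) + spanEnd a i  ≡⟨ cong (_+ spanEnd a i) (spanStart-after b′ a′ e) ⟩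
      s′ + spanStart a′ (suc e) + spanEnd a i            ≡⟨ +-assoc s′ _ _ ⟩
      s′ + (spanStart a′ (suc e) + spanEnd a i)          ≡⟨ cong (s′ +_) (ih-a 1≤i (s≤s z≤n) i+e≡s) ⟩
      s′ + s                                             ≡⟨ +-comm s′ s ⟩
      s + s′                                             ≡⟨ size-node ⟨
      suc (size (node a b))                              ∎
      where
      i+e≡s : i + suc e ≡ s
      i+e≡s = +-cancelˡ-≡ s′ _ _ (trans (x∙yz≈y∙xz s′ i (suc e)) (trans i+k≡ (+-comm s s′)))
    spans {i} {k} 1≤i 1≤k i+k≡ | at = begin
      spanStart (node b′ a′) k + size (node a b)   ≡⟨ cong (λ k → spanStart (node b′ a′) k + _) k≡s′ ⟩
      spanStart (node b′ a′) s′ + size (node a b)  ≡⟨ cong (_+ size (node a b)) (spanStart-root b′ a′) ⟩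
      suc (size (node a b))                        ∎
      where
      k≡s′ : k ≡ s′
      k≡s′ = +-cancelˡ-≡ s _ _ i+k≡
    spans {i} {k} 1≤i 1≤k i+k≡ | after d = begin
      spanStart (node b′ a′) k + (s + spanEnd b (suc d))  ≡⟨ cong (_+ _) (spanStart-before b′ a′ k<s′) ⟩
      spanStart b′ k + (s + spanEnd b (suc d))            ≡⟨ x∙yz≈y∙xz (spanStart b′ k) s _ ⟩
      s + (spanStart b′ k + spanEnd b (suc d))            ≡⟨ cong (s +_) (ih-b (s≤s z≤n) 1≤k d+k≡sb) ⟩
      s + suc (size b)                                    ≡⟨ +-suc s (size b) ⟩
      suc (size (node a b))                               ∎
      where
      d+k≡s′ : suc d + k ≡ s′
      d+k≡s′ = +-cancelˡ-≡ s _ _ (trans (sym (+-assoc s (suc d) k)) i+k≡)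
      d+k≡sb : suc d + k ≡ suc (size b)
      d+k≡sb = trans d+k≡s′ (cong suc (size-mirror b))
      k<s′ : k < s′
      k<s′ = subst (k <_) d+k≡s′ (m<n+m k z<s)

  mirrorSpans-node : MirrorSpans (node a b)
  mirrorSpans-node 1≤i 1≤k i+k≡ = spans 1≤i 1≤k (trans i+k≡ size-node)

mirrorSpans : ∀ t → MirrorSpans t
mirrorSpans leaf {suc i} {suc k} _ _ i+k≡1 = ⊥-elim (m+1+n≢0 i (cong pred i+k≡1))
mirrorSpans (node a b)                     = mirrorSpans-node (mirrorSpans a) (mirrorSpans b)

spanStart-mirror-antitone : ∀ τ σ → size τ ≡ size σ → spanStart τ ≤[ size τ ] spanStart σ →
                            spanStart (mirror σ) ≤[ size τ ] spanStart (mirror τ)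
spanStart-mirror-antitone τ σ same start≤ {k} 1≤k k≤n with m≤n⇒∃[o]m+o≡n k≤n
... | o , k+o≡n = +-cancelʳ-≤ (spanEnd σ i) _ _ (begin
  spanStart (mirror σ) k + spanEnd σ i  ≡⟨ mirrorSpans σ (s≤s z≤n) 1≤k (trans i+k≡ (cong suc same)) ⟩
  suc (size σ)                          ≡⟨ cong suc same ⟨
  suc (size τ)                          ≡⟨ mirrorSpans τ (s≤s z≤n) 1≤k i+k≡ ⟨
  spanStart (mirror τ) k + spanEnd τ i  ≤⟨ +-monoʳ-≤ _ (spanEnd-mono τ σ same start≤ (s≤s z≤n) i≤n) ⟩
  spanStart (mirror τ) k + spanEnd σ i  ∎)
  where
  open ≤-Reasoning
  i = suc o
  i+k≡ : i + k ≡ suc (size τ)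
  i+k≡ = cong suc (trans (+-comm o k) k+o≡n)
  i≤n : i ≤ size τ
  i≤n = subst (i ≤_) k+o≡n (+-monoˡ-≤ o 1≤k)

-- Names are subtree starts

leaves≡suc-size : ∀ t → leaves t ≡ suc (size t)
leaves≡suc-size leaf       = refl
leaves≡suc-size (node a b) =
  trans (cong₂ _+_ (leaves≡suc-size a) (leaves≡suc-size b)) (cong suc (+-suc (size a) (size b)))

leaves-left< : ∀ k a b → k + leaves a < k + leaves (node a b)
leaves-left< k a b = +-monoʳ-< k (m<m+n (leaves a) (subst (0 <_) (sym (leaves≡suc-size b)) z<s))

module _ (k : ℕ) (a b : Tree) where

  toks-node-++ : ∀ rest → toks k (node a b) ++ rest ≡ L ∷ toks k a ++ toks (k + leaves a) b ++ R ∷ rest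
  toks-node-++ rest =
    cong (L ∷_) (trans (++-assoc (toks k a) _ rest) (cong (toks k a ++_) (++-assoc (toks (k + leaves a) b) [ R ] rest)))

  toks-node-ʳ++ : ∀ ps → toks k (node a b) ʳ++ ps ≡ R ∷ toks (k + leaves a) b ʳ++ toks k a ʳ++ L ∷ ps
  toks-node-ʳ++ ps = trans (++-ʳ++ (toks k a)) (++-ʳ++ (toks (k + leaves a) b))

-- Read backwards, the tokens of a subtree are balanced, so a scan at positive depth passes
-- over them and leaves the subtree's first variable as the current one.
scan-skip : ∀ t k d v ps → scan (suc d) v (toks k t ʳ++ ps) ≡ scan (suc d) (suc k) ps
scan-skip leaf       k d v ps = refl
scan-skip (node a b) k d v ps = begin
  scan (suc d) v (toks k (node a b) ʳ++ ps)                             ≡⟨ cong (scan (suc d) v) (toks-node-ʳ++ k a b ps) ⟩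
  scan (suc (suc d)) v (toks (k + leaves a) b ʳ++ toks k a ʳ++ L ∷ ps)  ≡⟨ scan-skip b (k + leaves a) (suc d) v _ ⟩
  scan (suc (suc d)) (suc (k + leaves a)) (toks k a ʳ++ L ∷ ps)         ≡⟨ scan-skip a k (suc d) _ (L ∷ ps) ⟩
  scan (suc d) (suc k) ps                                               ∎
  where open ≡-Reasoning

decideAt-toks : ∀ t k i ps rest → decideAt i (toks k t ʳ++ ps) rest ≡ scan (countR rest) i (toks k t ʳ++ ps)
decideAt-toks leaf       k i ps rest = refl
decideAt-toks (node a b) k i ps rest rewrite toks-node-ʳ++ k a b ps = refl

countR-toks : ∀ t k xs → countR (toks k t ++ xs) ≡ 0
countR-toks leaf       k xs = refl
countR-toks (node a b) k xs = refl

findVar-here : ∀ {i j} pre rest → j ≡ i → findVar i pre (V j ∷ rest) ≡ decideAt i pre rest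
findVar-here {i} {j} pre rest j≡i with j ≟ i
... | yes _   = refl
... | no  j≢i = ⊥-elim (j≢i j≡i)

findVar-skip : ∀ t k {i} pre rest → k + leaves t < i →
               findVar i pre (toks k t ++ rest) ≡ findVar i (toks k t ʳ++ pre) rest
findVar-skip leaf k {i} pre rest k+1<i with suc k ≟ i
... | yes refl = ⊥-elim (<-irrefl (+-comm k 1) k+1<i)
... | no  _    = refl
findVar-skip (node a b) k {i} pre rest k+n<i = begin
  findVar i pre (toks k (node a b) ++ rest)
    ≡⟨ cong (findVar i pre) (toks-node-++ k a b rest) ⟩
  findVar i (L ∷ pre) (toks k a ++ toks k′ b ++ R ∷ rest)
    ≡⟨ findVar-skip a k (L ∷ pre) _ (≤-<-trans (m≤m+n k′ (leaves b)) k′+b<i) ⟩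
  findVar i (toks k a ʳ++ L ∷ pre) (toks k′ b ++ R ∷ rest)
    ≡⟨ findVar-skip b k′ _ (R ∷ rest) k′+b<i ⟩
  findVar i (toks k′ b ʳ++ toks k a ʳ++ L ∷ pre) (R ∷ rest)
    ≡⟨ cong (λ ps → findVar i ps rest) (toks-node-ʳ++ k a b pre) ⟨
  findVar i (toks k (node a b) ʳ++ pre) rest  ∎
  where
  open ≡-Reasoning
  k′ = k + leaves a
  k′+b<i : k′ + leaves b < i
  k′+b<i = subst (_< i) (sym (+-assoc k (leaves a) (leaves b))) k+n<i

findVar-rightmost : ∀ a b k {i} pre rest → i ≡ k + leaves (node a b) →
                    findVar i (toks k a ʳ++ L ∷ pre) (toks (k + leaves a) b ++ R ∷ rest)
                      ≡ scan (suc (countR rest)) (suc k) (L ∷ pre)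
findVar-rightmost a leaf k {i} pre rest i≡ = begin
  findVar i (toks k a ʳ++ L ∷ pre) (V (suc (k + leaves a)) ∷ R ∷ rest)  ≡⟨ findVar-here _ (R ∷ rest) (sym i≡k′+1) ⟩
  decideAt i (toks k a ʳ++ L ∷ pre) (R ∷ rest)                          ≡⟨ decideAt-toks a k i (L ∷ pre) (R ∷ rest) ⟩
  scan (suc (countR rest)) i (toks k a ʳ++ L ∷ pre)                     ≡⟨ scan-skip a k (countR rest) i (L ∷ pre) ⟩
  scan (suc (countR rest)) (suc k) (L ∷ pre)                            ∎
  where
  open ≡-Reasoning
  i≡k′+1 : i ≡ suc (k + leaves a)
  i≡k′+1 = trans i≡ (trans (sym (+-assoc k (leaves a) 1)) (+-comm (k + leaves a) 1))
findVar-rightmost a (node b₁ b₂) k {i} pre rest i≡ = begin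
  findVar i X (toks k′ (node b₁ b₂) ++ R ∷ rest)
    ≡⟨ cong (findVar i X) (toks-node-++ k′ b₁ b₂ (R ∷ rest)) ⟩
  findVar i (L ∷ X) (toks k′ b₁ ++ toks (k′ + leaves b₁) b₂ ++ R ∷ R ∷ rest)
    ≡⟨ findVar-skip b₁ k′ (L ∷ X) _ k′+b₁<i ⟩
  findVar i (toks k′ b₁ ʳ++ L ∷ X) (toks (k′ + leaves b₁) b₂ ++ R ∷ R ∷ rest)
    ≡⟨ findVar-rightmost b₁ b₂ k′ X (R ∷ rest) i≡k′+b ⟩
  scan (suc (countR rest)) (suc k′) X
    ≡⟨ scan-skip a k (countR rest) _ (L ∷ pre) ⟩
  scan (suc (countR rest)) (suc k) (L ∷ pre)  ∎
  where
  open ≡-Reasoning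
  k′ = k + leaves a
  X = toks k a ʳ++ L ∷ pre
  i≡k′+b : i ≡ k′ + leaves (node b₁ b₂)
  i≡k′+b = trans i≡ (sym (+-assoc k (leaves a) _))
  k′+b₁<i : k′ + leaves b₁ < i
  k′+b₁<i = subst (k′ + leaves b₁ <_) (sym i≡k′+b) (leaves-left< k′ b₁ b₂)

findVar-root : ∀ a b k {i} pre rest → i ≡ k + leaves a → findVar i pre (toks k (node a b) ++ rest) ≡ suc k
findVar-root leaf b k {i} pre rest i≡k+1 = begin
  findVar i pre (toks k (node leaf b) ++ rest)                  ≡⟨ cong (findVar i pre) (toks-node-++ k leaf b rest) ⟩
  findVar i (L ∷ pre) (V (suc k) ∷ toks (k + 1) b ++ R ∷ rest)  ≡⟨ findVar-here (L ∷ pre) _ (sym i≡1+k) ⟩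
  i                                                             ≡⟨ i≡1+k ⟩
  suc k                                                         ∎
  where
  open ≡-Reasoning
  i≡1+k : i ≡ suc k
  i≡1+k = trans i≡k+1 (+-comm k 1)
findVar-root (node a₁ a₂) b k {i} pre rest i≡ = begin
  findVar i pre (toks k (node (node a₁ a₂) b) ++ rest)
    ≡⟨ cong (findVar i pre) (toks-node-++ k (node a₁ a₂) b rest) ⟩
  findVar i (L ∷ pre) (toks k (node a₁ a₂) ++ rest′)
    ≡⟨ cong (findVar i (L ∷ pre)) (toks-node-++ k a₁ a₂ rest′) ⟩
  findVar i (L ∷ L ∷ pre) (toks k a₁ ++ toks (k + leaves a₁) a₂ ++ R ∷ rest′)
    ≡⟨ findVar-skip a₁ k (L ∷ L ∷ pre) _ k+a₁<i ⟩
  findVar i (toks k a₁ ʳ++ L ∷ L ∷ pre) (toks (k + leaves a₁) a₂ ++ R ∷ rest′)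
    ≡⟨ findVar-rightmost a₁ a₂ k (L ∷ pre) rest′ i≡ ⟩
  scan (suc (countR rest′)) (suc k) (L ∷ L ∷ pre)
    ≡⟨ cong (λ d → scan (suc d) (suc k) (L ∷ L ∷ pre)) (countR-toks b (k + leaves (node a₁ a₂)) (R ∷ rest)) ⟩
  suc k  ∎
  where
  open ≡-Reasoning
  rest′ = toks (k + leaves (node a₁ a₂)) b ++ R ∷ rest
  k+a₁<i : k + leaves a₁ < i
  k+a₁<i = subst (k + leaves a₁ <_) (sym i≡) (leaves-left< k a₁ a₂)

findVar-toks : ∀ t k {i j} pre rest → i ≡ k + j → 1 ≤ j → j ≤ size t →
               findVar i pre (toks k t ++ rest) ≡ k + spanStart t j
findVar-toks leaf k pre rest i≡ () z≤n
findVar-toks (node a b) k {i} {j} pre rest i≡ 1≤j j≤n with split (suc (size a)) j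
... | before j<s = trans (cong (findVar i pre) (toks-node-++ k a b rest))
                         (findVar-toks a k (L ∷ pre) _ i≡ 1≤j (≤-pred j<s))
... | at         = trans (findVar-root a b k pre rest (trans i≡ (cong (k +_) (sym (leaves≡suc-size a)))))
                         (+-comm 1 k)
... | after d    = begin
  findVar i pre (toks k (node a b) ++ rest)
    ≡⟨ cong (findVar i pre) (toks-node-++ k a b rest) ⟩
  findVar i (L ∷ pre) (toks k a ++ toks k′ b ++ R ∷ rest)
    ≡⟨ findVar-skip a k (L ∷ pre) _ k′<i ⟩
  findVar i (toks k a ʳ++ L ∷ pre) (toks k′ b ++ R ∷ rest)
    ≡⟨ findVar-toks b k′ _ (R ∷ rest) i≡k′+d (s≤s z≤n) (+-cancelˡ-≤ (suc (size a)) _ _ j≤n) ⟩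
  k′ + spanStart b (suc d)
    ≡⟨ cong (λ l → k + l + spanStart b (suc d)) (leaves≡suc-size a) ⟩
  k + suc (size a) + spanStart b (suc d)
    ≡⟨ +-assoc k _ _ ⟩
  k + (suc (size a) + spanStart b (suc d))  ∎
  where
  open ≡-Reasoning
  k′ = k + leaves a
  i≡k′+d : i ≡ k′ + suc d
  i≡k′+d = trans i≡ (trans (cong (λ l → k + (l + suc d)) (sym (leaves≡suc-size a)))
                           (sym (+-assoc k (leaves a) (suc d))))
  k′<i : k′ < i
  k′<i = subst (k′ <_) (sym i≡k′+d) (m<m+n k′ z<s)

module _ {R : ℕ → ℕ → Set} where

  Pointwise-applyUpTo⁺ : ∀ {f g} n → (∀ {i} → i < n → R (f i) (g i)) → Pointwise R (applyUpTo f n) (applyUpTo g n)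
  Pointwise-applyUpTo⁺ zero    Rfg = []
  Pointwise-applyUpTo⁺ (suc n) Rfg = Rfg z<s ∷ Pointwise-applyUpTo⁺ n (Rfg ∘ s≤s)

  Pointwise-applyUpTo⁻ : ∀ {f g} n → Pointwise R (applyUpTo f n) (applyUpTo g n) → ∀ {i} → i < n → R (f i) (g i)
  Pointwise-applyUpTo⁻ (suc n) (Rfg ∷ _)  {zero}  _         = Rfg
  Pointwise-applyUpTo⁻ (suc n) (_ ∷ Rfgs) {suc i} (s≤s i<n) = Pointwise-applyUpTo⁻ n Rfgs i<n

name-spanStart : ∀ t → name t ≡ applyUpTo (spanStart t ∘ suc) (size t)
name-spanStart t =
  trans (map-cong-local (All.tabulate (λ i∈ → findVar-first (∈-upTo⁻ i∈)))) (map-upTo (spanStart t ∘ suc) (size t))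
  where
  findVar-first : ∀ {i} → i < size t → findVar (suc i) [] (toks zero t) ≡ spanStart t (suc i)
  findVar-first {i} i<n =
    trans (cong (findVar (suc i) []) (sym (++-identityʳ (toks zero t)))) (findVar-toks t zero [] [] refl (s≤s z≤n) i<n)

length-name : ∀ t → length (name t) ≡ size t
length-name t = trans (length-map _ (upTo (size t))) (length-upTo (size t))

≤ᶜ⇒size≡ : ∀ {τ σ} → name τ ≤ᶜ name σ → size τ ≡ size σ
≤ᶜ⇒size≡ {τ} {σ} τ≤σ = trans (sym (length-name τ)) (trans (Pointwise.Pointwise-length τ≤σ) (length-name σ))

≤ᶜ⇒spanStart-≤ : ∀ {τ σ} → name τ ≤ᶜ name σ → spanStart τ ≤[ size τ ] spanStart σ
≤ᶜ⇒spanStart-≤ {τ} {σ} τ≤σ {suc i} _ i<n = Pointwise-applyUpTo⁻ (size τ) starts≤ i<n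
  where
  starts≤ : applyUpTo (spanStart τ ∘ suc) (size τ) ≤ᶜ applyUpTo (spanStart σ ∘ suc) (size τ)
  starts≤ = subst₂ _≤ᶜ_ (name-spanStart τ) (trans (name-spanStart σ) (cong (applyUpTo _) (sym (≤ᶜ⇒size≡ τ≤σ))))
                   τ≤σ

spanStart-≤⇒≤ᶜ : ∀ {τ σ} → size τ ≡ size σ → spanStart τ ≤[ size τ ] spanStart σ → name τ ≤ᶜ name σ
spanStart-≤⇒≤ᶜ {τ} {σ} same start≤ =
  subst₂ _≤ᶜ_ (sym (name-spanStart τ)) (sym (trans (name-spanStart σ) (cong (applyUpTo _) (sym same))))
         (Pointwise-applyUpTo⁺ (size τ) (start≤ (s≤s z≤n)))

name-antitone : ∀ {τ σ} → name τ ≤ᶜ name σ → name (mirror σ) ≤ᶜ name (mirror τ)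
name-antitone {τ} {σ} τ≤σ =
  spanStart-≤⇒≤ᶜ mσ≡mτ (subst (λ n → spanStart (mirror σ) ≤[ n ] spanStart (mirror τ)) τ≡mσ
                               (spanStart-mirror-antitone τ σ τ≡σ (≤ᶜ⇒spanStart-≤ τ≤σ)))
  where
  τ≡σ : size τ ≡ size σ
  τ≡σ = ≤ᶜ⇒size≡ τ≤σ
  τ≡mσ : size τ ≡ size (mirror σ)
  τ≡mσ = trans τ≡σ (sym (size-mirror σ))
  mσ≡mτ : size (mirror σ) ≡ size (mirror τ)
  mσ≡mτ = trans (sym τ≡mσ) (sym (size-mirror τ))

name-mirror-cong : ∀ {τ σ} → name τ ≡ name σ → name (mirror τ) ≡ name (mirror σ)
name-mirror-cong {τ} τ≡σ = ≤ᶜ-antisym (name-antitone (subst (_≤ᶜ name τ) τ≡σ ≤ᶜ-refl))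
                                      (name-antitone (subst (name τ ≤ᶜ_) τ≡σ ≤ᶜ-refl))

name-mirror-<ᶜ : ∀ {τ σ} → name τ <ᶜ name σ → name (mirror σ) <ᶜ name (mirror τ)
name-mirror-<ᶜ {τ} {σ} (τ≤σ , τ≢σ) = name-antitone τ≤σ , λ mσ≡mτ →
  τ≢σ (sym (subst₂ (λ σ′ τ′ → name σ′ ≡ name τ′) (mirror-involutive σ) (mirror-involutive τ)
                   (name-mirror-cong mσ≡mτ)))

treesUpTo-complete : ∀ k t → size t ≤ k → t ∈ treesUpTo k
treesUpTo-complete zero    leaf       _         = here refl
treesUpTo-complete (suc k) leaf       _         = here refl
treesUpTo-complete (suc k) (node a b) (s≤s n≤k) =
  there (∈-concatMap⁺ (λ a′ → map (node a′) (treesUpTo k))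
           (lose (treesUpTo-complete k a (≤-trans (m≤m+n (size a) (size b)) n≤k))
                 (∈-map⁺ (node a) (treesUpTo-complete k b (≤-trans (m≤n+m (size b) (size a)) n≤k)))))

∈-Y⁺ : ∀ {n t} → size t ≡ n → t ∈ Y n
∈-Y⁺ {n} {t} refl = ∈-filter⁺ (λ t → size t ≟ n) (treesUpTo-complete n t ≤-refl) refl

∈-Y⁻ : ∀ {n t} → t ∈ Y n → size t ≡ n
∈-Y⁻ {n} = proj₂ ∘ ∈-filter⁻ (λ t → size t ≟ n) {xs = treesUpTo n}

name-∈-Names : ∀ {n t} → size t ≡ n → name t ∈ Names n
name-∈-Names = ∈-deduplicate⁺ _≟ᴸ_ ∘ ∈-map⁺ name ∘ ∈-Y⁺

∈-Names⁻ : ∀ {n x} → x ∈ Names n → ∃[ t ] size t ≡ n × x ≡ name t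
∈-Names⁻ {n} x∈ with ∈-map⁻ name (∈-deduplicate⁻ _≟ᴸ_ (map name (Y n)) x∈)
... | t , t∈Y , x≡ = t , ∈-Y⁻ t∈Y , x≡

-- leaf is a junk value for a name that no tree in the list has.
treeNamed : List Tree → List ℕ → Tree
treeNamed []       x = leaf
treeNamed (t ∷ ts) x with name t ≟ᴸ x
... | yes _ = t
... | no  _ = treeNamed ts x

name-treeNamed : ∀ {t ts} → t ∈ ts → name (treeNamed ts (name t)) ≡ name t
name-treeNamed {t} {t′ ∷ ts} t∈ with name t′ ≟ᴸ name t
name-treeNamed _            | yes t′≡t = t′≡t
name-treeNamed (here refl)  | no  t′≢t = ⊥-elim (t′≢t refl)
name-treeNamed (there t∈ts) | no  _    = name-treeNamed t∈ts

module _ (n : ℕ) where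

  dual : List ℕ → List ℕ
  dual x = name (mirror (treeNamed (Y n) x))

  dual-name : ∀ {t} → size t ≡ n → dual (name t) ≡ name (mirror t)
  dual-name t-size = name-mirror-cong (name-treeNamed (∈-Y⁺ t-size))

  dual-∈ : ∀ {x} → x ∈ Names n → dual x ∈ Names n
  dual-∈ x∈ with ∈-Names⁻ x∈
  ... | t , t-size , refl = subst (_∈ Names n) (sym (dual-name t-size)) (name-∈-Names (trans (size-mirror t) t-size))

  dual-involutive : ∀ {x} → x ∈ Names n → dual (dual x) ≡ x
  dual-involutive x∈ with ∈-Names⁻ x∈
  ... | t , t-size , refl = begin
    dual (dual (name t))     ≡⟨ cong dual (dual-name t-size) ⟩
    dual (name (mirror t))   ≡⟨ dual-name (trans (size-mirror t) t-size) ⟩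
    name (mirror (mirror t)) ≡⟨ cong name (mirror-involutive t) ⟩
    name t                   ∎
    where open ≡-Reasoning

  dual-antitone : ∀ {x y} → x ∈ Names n → y ∈ Names n → x ≤ᶜ y → dual y ≤ᶜ dual x
  dual-antitone x∈ y∈ x≤y with ∈-Names⁻ x∈ | ∈-Names⁻ y∈
  ... | t , t-size , refl | s , s-size , refl =
    subst₂ _≤ᶜ_ (sym (dual-name s-size)) (sym (dual-name t-size)) (name-antitone x≤y)

  μ-dual : ∀ {x y} → x ∈ Names n → y ∈ Names n → μ n x y ≡ μ n (dual y) (dual x)
  μ-dual = Chains.mobiusFuel-dual (Names n) (deduplicate-! (map name (Y n)))
             dual dual-∈ dual-involutive dual-antitone (length (Names n))

proposition3p8 : (n : ℕ) → 1 ≤ n → (τ σ : Tree) → size τ ≡ n → size σ ≡ n →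
    ((name τ <ᶜ name σ) ⇔ (name (mirror σ) <ᶜ name (mirror τ)))
    × (μ n (name τ) (name σ) ≡ μ n (name (mirror σ)) (name (mirror τ)))
proposition3p8 n _ τ σ τ-size σ-size = mk⇔ name-mirror-<ᶜ from-mirrored , μ-mirror
  where
  from-mirrored : name (mirror σ) <ᶜ name (mirror τ) → name τ <ᶜ name σ
  from-mirrored =
    subst₂ (λ τ′ σ′ → name τ′ <ᶜ name σ′) (mirror-involutive τ) (mirror-involutive σ) ∘ name-mirror-<ᶜ
  μ-mirror : μ n (name τ) (name σ) ≡ μ n (name (mirror σ)) (name (mirror τ))
  μ-mirror = trans (μ-dual n (name-∈-Names τ-size) (name-∈-Names σ-size))
                   (cong₂ (μ n) (dual-name n σ-size) (dual-name n τ-size))
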